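{- Let $G$ be an abelian group, let $r, m \geq 1$ be integers and put $h = mr$. Let $A \subseteq G$ be a finite set with $|A| = k$ and $rk \geq h \geq 1$. Then $$h^{(r)} A = r\,(m^{\wedge} A),$$ where $r\,(m^{\wedge} A)$ denotes the $r$-fold sumset $\{x_1 + \dots + x_r : x_1, \dots, x_r \in m^{\wedge} A\}$ of the set $m^{\wedge} A$.
   Context: For a finite set $A = \{a_1, \dots, a_k\}$ of $k$ distinct elements of an abelian group $G$ and integers $h, r \geq 1$, the generalized $h$-fold sumset is $$h^{(r)} A = \left\{ \sum_{i=1}^k r_i a_i : 0 \leq r_i \leq r \text{ for } i = 1, \dots, k \text{ and } \sum_{i=1}^k r_i = h \right\}.$$ For an integer $m \geq 1$, the restricted sumset $m^{\wedge} A$ is the set of all sums $a_{j_1} + \dots + a_{j_m}$ with $a_{j_1}, \dots, a_{j_m} \in A$ pairwise distinct elements (equivalently $m^{\wedge} A = m^{(1)} A$). -}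

module Defs where

open import Level using (Level; _⊔_)
open import Algebra.Bundles using (AbelianGroup)
open import Data.Nat using (ℕ; zero; suc; _≤_; _+_)
open import Data.Fin using (Fin; zero; suc)
open import Data.Fin.Subset using (Subset; _∈_; ∣_∣)
open import Data.Fin.Subset.Properties using (_∈?_)
open import Data.Product using (Σ; _×_)
open import Relation.Binary.PropositionalEquality using (_≡_)
open import Relation.Nullary using (yes; no)

∑ℕ : (n : ℕ) → (Fin n → ℕ) → ℕ
∑ℕ zero    f = zero
∑ℕ (suc n) f = f zero + ∑ℕ n (λ i → f (suc i))

module _ {c ℓ : Level} (G : AbelianGroup c ℓ) where
  open AbelianGroup G

  -- subsets of G are given as predicates on the carrier (membership x ∈ B is B x)

  ∑ : (n : ℕ) → (Fin n → Carrier) → Carrier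
  ∑ zero    f = ε
  ∑ (suc n) f = f zero ∙ ∑ n (λ i → f (suc i))

  _·_ : ℕ → Carrier → Carrier
  zero  · x = ε
  suc n · x = x ∙ (n · x)

  Distinct : {k : ℕ} → (Fin k → Carrier) → Set ℓ
  Distinct {k} a = ∀ (i j : Fin k) → a i ≈ a j → i ≡ j

  genSumset : {k : ℕ} → (Fin k → Carrier) → (h r : ℕ) → Carrier → Set ℓ
  genSumset {k} a h r x =
    Σ (Fin k → ℕ) λ rs →
      (∀ i → rs i ≤ r) × (∑ℕ k rs ≡ h) × (x ≈ ∑ k (λ i → rs i · a i))

  subsetSum : {k : ℕ} → (Fin k → Carrier) → Subset k → Carrier
  subsetSum {k} a S = ∑ k (λ i → f i (i ∈? S))
    where
      f : (i : Fin k) → _ → Carrier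
      f i (yes _) = a i
      f i (no  _) = ε

  restrSumset : {k : ℕ} → (Fin k → Carrier) → (m : ℕ) → Carrier → Set ℓ
  restrSumset {k} a m x =
    Σ (Subset k) λ S → (∣ S ∣ ≡ m) × (x ≈ subsetSum a S)

  foldSumset : {ℓ′ : Level} (r : ℕ) → (Carrier → Set ℓ′) → Carrier → Set (c ⊔ ℓ ⊔ ℓ′)
  foldSumset r B x =
    Σ (Fin r → Carrier) λ xs → (∀ j → B (xs j)) × (x ≈ ∑ r xs)

{-# OPTIONS --safe #-}
module Submission where

-- Write x ∈ h^(r) A as Σ rᵢ aᵢ and list every index i rᵢ times, index after index.
-- Dealing this list of h = m r entries round-robin into r rows puts the rᵢ ≤ r copies
-- of i into distinct rows and gives every row exactly m entries, so each row is an
-- m-element subset and x is a sum of r elements of m^∧ A.  Conversely, r subsets of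
-- size m give the multiplicities rᵢ = #{j : i ∈ Sⱼ} ≤ r with Σ rᵢ = m r.

open import Defs
open import Level using (Level)
open import Algebra.Bundles using (AbelianGroup)
open import Data.Nat using (ℕ; _≤_; _*_)
open import Data.Fin using (Fin)
open import Data.Product using (_×_)
open import Relation.Binary.PropositionalEquality using (_≡_)

open import Function using (_∘_)
open import Data.Bool using (Bool; true; false; not; _∧_; _∨_)
open import Data.Nat using (zero; suc; _+_; _∸_; _<_; _<ᵇ_; z≤n; s≤s; _<?_; _%_)
open import Data.Nat.Properties
  using (+-0-commutativeMonoid; +-commutativeSemigroup; +-assoc; +-comm; +-suc; *-suc; *-zeroʳ;
         +-cancelʳ-≡; *-cancelʳ-≡; +-monoʳ-≤; +-mono-≤; ∸-monoˡ-≤; m+n∸n≡m; m∸n+n≡m;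
         ≤-trans; ≤-reflexive; ≤-<-trans; <⇒≤; ≮⇒≥)
open import Data.Nat.DivMod using (m<n⇒m%n≡m; [m+kn]%n≡m%n; m*n%n≡0)
open import Data.Fin using (zero; suc; toℕ)
open import Data.Fin.Subset using (Subset; ∣_∣)
open import Data.Fin.Subset.Properties using (_∈?_)
open import Data.Vec using ([]; _∷_)
open import Data.Product using (Σ; _,_; proj₁; proj₂)
open import Relation.Nullary using (yes; no; does)
open import Relation.Binary.PropositionalEquality using (refl; sym; trans; cong; cong₂; subst; module ≡-Reasoning)
open import Algebra.Properties.CommutativeSemigroup +-commutativeSemigroup using (xy∙z≈xz∙y)
import Algebra.Properties.CommutativeMonoid.Sum as MonoidSum
import Algebra.Properties.Monoid.Mult as MonoidMult
import Relation.Binary.Reasoning.Setoid as SetoidReasoning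

module ℕΣ = MonoidSum +-0-commutativeMonoid
open ℕΣ using (sum-syntax; sum-cong-≗)

Bool→ℕ : Bool → ℕ
Bool→ℕ false = 0
Bool→ℕ true  = 1

∑ℕ≡sum : ∀ n (f : Fin n → ℕ) → ∑ℕ n f ≡ ∑[ i < n ] f i
∑ℕ≡sum zero    f = refl
∑ℕ≡sum (suc n) f = cong (f zero +_) (∑ℕ≡sum n (f ∘ suc))

sum-const : ∀ n c → ∑[ i < n ] c ≡ c * n
sum-const zero    c = sym (*-zeroʳ c)
sum-const (suc n) c = trans (cong (c +_) (sum-const n c)) (sym (*-suc c n))

sum-Bool→ℕ≤ : ∀ n (b : Fin n → Bool) → ∑[ i < n ] Bool→ℕ (b i) ≤ n
sum-Bool→ℕ≤ zero    b = z≤n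
sum-Bool→ℕ≤ (suc n) b = +-mono-≤ (Bool→ℕ≤1 (b zero)) (sum-Bool→ℕ≤ n (b ∘ suc))
  where
    Bool→ℕ≤1 : ∀ x → Bool→ℕ x ≤ 1
    Bool→ℕ≤1 false = z≤n
    Bool→ℕ≤1 true  = s≤s z≤n

-- Row sizes after dealing s + q * r entries round-robin: q in every row, one more in the first s.
staircase : {r : ℕ} → ℕ → ℕ → Fin r → ℕ
staircase q s j = Bool→ℕ (toℕ j <ᵇ s) + q

sum-<ᵇ : ∀ n {s} → s ≤ n → ∑[ j < n ] Bool→ℕ (toℕ j <ᵇ s) ≡ s
sum-<ᵇ zero    z≤n       = refl
sum-<ᵇ (suc n) z≤n       = sum-const (suc n) 0
sum-<ᵇ (suc n) (s≤s s≤n) = cong suc (sum-<ᵇ n s≤n)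

sum-staircase : ∀ r q {s} → s ≤ r → ∑[ j < r ] staircase q s j ≡ s + q * r
sum-staircase r q {s} s≤r =
  trans (ℕΣ.∑-distrib-+ {r} (λ j → Bool→ℕ (toℕ j <ᵇ s)) (λ _ → q))
        (cong₂ _+_ (sum-<ᵇ r s≤r) (sum-const r q))

<ᵇ-split : ∀ t s c → Bool→ℕ (not (t <ᵇ s) ∧ (t <ᵇ s + c)) + Bool→ℕ (t <ᵇ s) ≡ Bool→ℕ (t <ᵇ s + c)
<ᵇ-split t       zero    c = +-comm _ 0
<ᵇ-split zero    (suc s) c = refl
<ᵇ-split (suc t) (suc s) c = <ᵇ-split t s c

<ᵇ-wrap : ∀ t {s′ s} → s′ ≤ s → Bool→ℕ ((t <ᵇ s′) ∨ not (t <ᵇ s)) + Bool→ℕ (t <ᵇ s) ≡ suc (Bool→ℕ (t <ᵇ s′))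
<ᵇ-wrap t {zero} {s} z≤n with t <ᵇ s
... | true  = refl
... | false = refl
<ᵇ-wrap zero    (s≤s s′≤s) = refl
<ᵇ-wrap (suc t) (s≤s s′≤s) = <ᵇ-wrap t s′≤s

+-staircase : ∀ {r} x q s (j : Fin r) → x + staircase q s j ≡ (x + Bool→ℕ (toℕ j <ᵇ s)) + q
+-staircase x q s j = sym (+-assoc x (Bool→ℕ (toℕ j <ᵇ s)) q)

record StaircaseStep (r c q s : ℕ) : Set where
  field
    column : Fin r → Bool
    q′ s′  : ℕ
    s′<r   : s′ < r
    rows   : ∀ j → Bool→ℕ (column j) + staircase q s j ≡ staircase q′ s′ j
    total  : s′ + q′ * r ≡ (s + q * r) + c

  column-sum : s ≤ r → ∑[ j < r ] Bool→ℕ (column j) ≡ c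
  column-sum s≤r = +-cancelʳ-≡ (s + q * r) _ c (begin
      ∑[ j < r ] Bool→ℕ (column j) + (s + q * r)
    ≡⟨ cong (∑[ j < r ] Bool→ℕ (column j) +_) (sum-staircase r q s≤r) ⟨
      ∑[ j < r ] Bool→ℕ (column j) + ∑[ j < r ] staircase q s j
    ≡⟨ ℕΣ.∑-distrib-+ (Bool→ℕ ∘ column) (staircase q s) ⟨
      ∑[ j < r ] (Bool→ℕ (column j) + staircase q s j)
    ≡⟨ sum-cong-≗ rows ⟩
      ∑[ j < r ] staircase q′ s′ j
    ≡⟨ sum-staircase r q′ (<⇒≤ s′<r) ⟩
      s′ + q′ * r
    ≡⟨ total ⟩
      (s + q * r) + c
    ≡⟨ +-comm (s + q * r) c ⟩
      c + (s + q * r)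
    ∎)
    where open ≡-Reasoning

step-within : ∀ {r c q s} → s + c < r → StaircaseStep r c q s
step-within {r} {c} {q} {s} s+c<r = record
  { column = λ j → not (toℕ j <ᵇ s) ∧ (toℕ j <ᵇ s + c)
  ; q′     = q
  ; s′     = s + c
  ; s′<r   = s+c<r
  ; rows   = λ j → trans (+-staircase _ q s j) (cong (_+ q) (<ᵇ-split (toℕ j) s c))
  ; total  = xy∙z≈xz∙y s c (q * r)
  }

step-wrap : ∀ {r c q s} → s < r → c ≤ r → r ≤ s + c → StaircaseStep r c q s
step-wrap {r} {c} {q} {s} s<r c≤r r≤s+c = record
  { column = λ j → (toℕ j <ᵇ s′) ∨ not (toℕ j <ᵇ s)
  ; q′     = suc q
  ; s′     = s′
  ; s′<r   = ≤-<-trans s′≤s s<r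
  ; rows   = λ j → trans (+-staircase _ q s j)
                     (trans (cong (_+ q) (<ᵇ-wrap (toℕ j) s′≤s)) (sym (+-suc _ q)))
  ; total  = begin
      s′ + (r + q * r)   ≡⟨ +-assoc s′ r (q * r) ⟨
      (s′ + r) + q * r   ≡⟨ cong (_+ q * r) (m∸n+n≡m r≤s+c) ⟩
      (s + c) + q * r    ≡⟨ xy∙z≈xz∙y s c (q * r) ⟩
      (s + q * r) + c    ∎
  }
  where
    open ≡-Reasoning
    s′ : ℕ
    s′ = s + c ∸ r
    s′≤s : s′ ≤ s
    s′≤s = ≤-trans (∸-monoˡ-≤ r (+-monoʳ-≤ s c≤r)) (≤-reflexive (m+n∸n≡m s r))

staircase-step : ∀ {r c q s} → s < r → c ≤ r → StaircaseStep r c q s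
staircase-step {r} {c} {s = s} s<r c≤r with s + c <? r
... | yes s+c<r = step-within s+c<r
... | no  s+c≮r = step-wrap s<r c≤r (≮⇒≥ s+c≮r)

remainder-unique : ∀ {r q s m} → s < r → s + q * r ≡ m * r → q ≡ m × s ≡ 0
remainder-unique {suc r} {q} {s} {m} s<r eq =
  *-cancelʳ-≡ q m (suc r) (subst (λ s → s + q * suc r ≡ m * suc r) s≡0 eq) , s≡0
  where
    open ≡-Reasoning
    s≡0 : s ≡ 0
    s≡0 = begin
      s                         ≡⟨ m<n⇒m%n≡m s<r ⟨
      s % suc r                 ≡⟨ [m+kn]%n≡m%n s q (suc r) ⟨
      (s + q * suc r) % suc r   ≡⟨ cong (_% suc r) eq ⟩
      (m * suc r) % suc r       ≡⟨ m*n%n≡0 m (suc r) ⟩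
      0                         ∎

multiplicity : ∀ {r k} → (Fin r → Subset k) → Fin k → ℕ
multiplicity {r} M i = ∑[ j < r ] Bool→ℕ (does (i ∈? M j))

∣∷∣ : ∀ {k} b (S : Subset k) → ∣ b ∷ S ∣ ≡ Bool→ℕ b + ∣ S ∣
∣∷∣ false S = refl
∣∷∣ true  S = refl

zero∈?∷ : ∀ {k} b (S : Subset k) → does (zero ∈? (b ∷ S)) ≡ b
zero∈?∷ false S = refl
zero∈?∷ true  S = refl

∣S∣≡sum : ∀ {k} (S : Subset k) → ∣ S ∣ ≡ ∑[ i < k ] Bool→ℕ (does (i ∈? S))
∣S∣≡sum []          = refl
∣S∣≡sum (false ∷ S) = ∣S∣≡sum S
∣S∣≡sum (true  ∷ S) = cong suc (∣S∣≡sum S)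

sum-multiplicity : ∀ {r k} (M : Fin r → Subset k) → ∑[ i < k ] multiplicity M i ≡ ∑[ j < r ] ∣ M j ∣
sum-multiplicity {r} {k} M =
  trans (sym (ℕΣ.∑-comm {r} {k} (λ j i → Bool→ℕ (does (i ∈? M j)))))
        (sum-cong-≗ (sym ∘ ∣S∣≡sum ∘ M))

sum-multiplicity-const : ∀ {r k m} (M : Fin r → Subset k) → (∀ j → ∣ M j ∣ ≡ m) → ∑ℕ k (multiplicity M) ≡ m * r
sum-multiplicity-const {r} {k} {m} M ∣M∣≡m = begin
  ∑ℕ k (multiplicity M)           ≡⟨ ∑ℕ≡sum k (multiplicity M) ⟩
  ∑[ i < k ] multiplicity M i     ≡⟨ sum-multiplicity M ⟩
  ∑[ j < r ] ∣ M j ∣               ≡⟨ sum-cong-≗ ∣M∣≡m ⟩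
  ∑[ j < r ] m                    ≡⟨ sum-const r m ⟩
  m * r                           ∎
  where open ≡-Reasoning

record RoundRobin (r : ℕ) {k : ℕ} (rs : Fin k → ℕ) : Set where
  field
    rows          : Fin r → Subset k
    multiplicity≡ : ∀ i → multiplicity rows i ≡ rs i
    q s           : ℕ
    s<r           : s < r
    ∣rows∣         : ∀ j → ∣ rows j ∣ ≡ staircase q s j

round-robin : ∀ {r k} (rs : Fin k → ℕ) → (∀ i → rs i ≤ r) → 0 < r → RoundRobin r rs
round-robin {k = zero} rs rs≤r 0<r = record
  { rows = λ _ → [] ; multiplicity≡ = λ () ; q = 0 ; s = 0 ; s<r = 0<r ; ∣rows∣ = λ _ → refl }
round-robin {k = suc k} rs rs≤r 0<r = record
  { rows          = λ j → column j ∷ R.rows j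
  ; multiplicity≡ = λ { zero    → trans (sum-cong-≗ (λ j → cong Bool→ℕ (zero∈?∷ (column j) (R.rows j))))
                                        (column-sum (<⇒≤ R.s<r))
                      ; (suc i) → R.multiplicity≡ i }
  ; q             = q′
  ; s             = s′
  ; s<r           = s′<r
  ; ∣rows∣         = λ j → trans (∣∷∣ (column j) (R.rows j))
                             (trans (cong (Bool→ℕ (column j) +_) (R.∣rows∣ j)) (rows j))
  }
  where
    module R = RoundRobin (round-robin (rs ∘ suc) (rs≤r ∘ suc) 0<r)
    open StaircaseStep (staircase-step {q = R.q} R.s<r (rs≤r zero))

equal-rows : ∀ {r k} m (rs : Fin k → ℕ) → (∀ i → rs i ≤ r) → 0 < r → ∑[ i < k ] rs i ≡ m * r →
  Σ (Fin r → Subset k) λ M → (∀ i → multiplicity M i ≡ rs i) × (∀ j → ∣ M j ∣ ≡ m)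
equal-rows {r} {k} m rs rs≤r 0<r ∑rs≡mr = rows , multiplicity≡ , ∣rows∣≡m
  where
    open RoundRobin (round-robin rs rs≤r 0<r)
    open ≡-Reasoning
    total : s + q * r ≡ m * r
    total = begin
      s + q * r                        ≡⟨ sum-staircase r q (<⇒≤ s<r) ⟨
      ∑[ j < r ] staircase q s j       ≡⟨ sum-cong-≗ ∣rows∣ ⟨
      ∑[ j < r ] ∣ rows j ∣             ≡⟨ sum-multiplicity rows ⟨
      ∑[ i < k ] multiplicity rows i   ≡⟨ sum-cong-≗ multiplicity≡ ⟩
      ∑[ i < k ] rs i                  ≡⟨ ∑rs≡mr ⟩
      m * r                            ∎
    ∣rows∣≡m : ∀ j → ∣ rows j ∣ ≡ m
    ∣rows∣≡m j = trans (∣rows∣ j) (cong₂ (λ q s → staircase q s j) (proj₁ q≡m×s≡0) (proj₂ q≡m×s≡0))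
      where
        q≡m×s≡0 : q ≡ m × s ≡ 0
        q≡m×s≡0 = remainder-unique s<r total

module _ {c ℓ : Level} (G : AbelianGroup c ℓ) where
  open AbelianGroup G using (Carrier; _≈_; _∙_; setoid; commutativeMonoid; monoid; ∙-congˡ; identityʳ)
  open AbelianGroup G using () renaming (refl to ≈-refl; sym to ≈-sym; trans to ≈-trans; reflexive to ≈-reflexive)
  open MonoidSum commutativeMonoid using (sum; sum-cong-≋; ∑-comm)
  open MonoidMult monoid using (×-homo-+; ×-congˡ) renaming (_×_ to _×ᴳ_)
  open SetoidReasoning setoid

  ∑≡sum : ∀ n (f : Fin n → Carrier) → ∑ G n f ≡ sum f
  ∑≡sum zero    f = refl
  ∑≡sum (suc n) f = cong (f zero ∙_) (∑≡sum n (f ∘ suc))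

  ·≡× : ∀ n x → _·_ G n x ≡ n ×ᴳ x
  ·≡× zero    x = refl
  ·≡× (suc n) x = cong (x ∙_) (·≡× n x)

  ∑·≈sum× : ∀ {k} (ns : Fin k → ℕ) (a : Fin k → Carrier) →
    ∑ G k (λ i → _·_ G (ns i) (a i)) ≈ sum (λ i → ns i ×ᴳ a i)
  ∑·≈sum× {k} ns a =
    ≈-trans (≈-reflexive (∑≡sum k _)) (sum-cong-≋ (λ i → ≈-reflexive (·≡× (ns i) (a i))))

  sum-× : ∀ {r} (ns : Fin r → ℕ) x → sum (λ j → ns j ×ᴳ x) ≈ (∑[ j < r ] ns j) ×ᴳ x
  sum-× {zero}  ns x = ≈-refl
  sum-× {suc r} ns x = ≈-trans (∙-congˡ (sum-× (ns ∘ suc) x)) (≈-sym (×-homo-+ x (ns zero) _))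

  -- subsetSum keeps its summand in a where-clause; unifying subsetSum with ∑ G k g names it.
  summand : ∀ {k} (a : Fin k → Carrier) (S : Subset k) → Fin k → Carrier
  summand {k} a S = exposed refl
    where
      exposed : {g : Fin k → Carrier} → subsetSum G a S ≡ ∑ G k g → Fin k → Carrier
      exposed {g} _ = g

  subsetSum≈sum : ∀ {k} (a : Fin k → Carrier) (S : Subset k) →
    subsetSum G a S ≈ sum (λ i → Bool→ℕ (does (i ∈? S)) ×ᴳ a i)
  subsetSum≈sum {k} a S = ≈-trans (≈-reflexive (∑≡sum k (summand a S))) (sum-cong-≋ summand≈)
    where
      summand≈ : ∀ i → summand a S i ≈ Bool→ℕ (does (i ∈? S)) ×ᴳ a i
      summand≈ i with i ∈? S
      ... | yes _ = ≈-sym (identityʳ (a i))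
      ... | no  _ = ≈-refl

  sum-subsetSum : ∀ {r k} (a : Fin k → Carrier) (M : Fin r → Subset k) →
    sum (λ j → subsetSum G a (M j)) ≈ sum (λ i → multiplicity M i ×ᴳ a i)
  sum-subsetSum a M = begin
    sum (λ j → subsetSum G a (M j))
      ≈⟨ sum-cong-≋ (λ j → subsetSum≈sum a (M j)) ⟩
    sum (λ j → sum (λ i → Bool→ℕ (does (i ∈? M j)) ×ᴳ a i))
      ≈⟨ ∑-comm (λ j i → Bool→ℕ (does (i ∈? M j)) ×ᴳ a i) ⟩
    sum (λ i → sum (λ j → Bool→ℕ (does (i ∈? M j)) ×ᴳ a i))
      ≈⟨ sum-cong-≋ (λ i → sum-× (λ j → Bool→ℕ (does (i ∈? M j))) (a i)) ⟩
    sum (λ i → multiplicity M i ×ᴳ a i)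
      ∎

  genSumset⇒foldSumset : ∀ {r m h k} (a : Fin k → Carrier) → 0 < r → h ≡ m * r → ∀ {x} →
    genSumset G a h r x → foldSumset G r (restrSumset G a m) x
  genSumset⇒foldSumset {r} {m} {k = k} a 0<r h≡mr {x} (rs , rs≤r , ∑rs≡h , x≈)
    with equal-rows m rs rs≤r 0<r (trans (sym (∑ℕ≡sum k rs)) (trans ∑rs≡h h≡mr))
  ... | M , multiplicity≡ , ∣M∣≡m =
    (λ j → subsetSum G a (M j)) ,
    (λ j → M j , ∣M∣≡m j , ≈-refl) ,
    (begin
      x                                     ≈⟨ x≈ ⟩
      ∑ G k (λ i → _·_ G (rs i) (a i))      ≈⟨ ∑·≈sum× rs a ⟩
      sum (λ i → rs i ×ᴳ a i)               ≈⟨ sum-cong-≋ (λ i → ×-congˡ (multiplicity≡ i)) ⟨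
      sum (λ i → multiplicity M i ×ᴳ a i)   ≈⟨ sum-subsetSum a M ⟨
      sum (λ j → subsetSum G a (M j))       ≡⟨ ∑≡sum r _ ⟨
      ∑ G r (λ j → subsetSum G a (M j))     ∎)

  foldSumset⇒genSumset : ∀ {r m h k} (a : Fin k → Carrier) → h ≡ m * r → ∀ {x} →
    foldSumset G r (restrSumset G a m) x → genSumset G a h r x
  foldSumset⇒genSumset {r} {k = k} a h≡mr {x} (xs , xs∈ , x≈) =
    multiplicity M ,
    (λ i → sum-Bool→ℕ≤ r (λ j → does (i ∈? M j))) ,
    trans (sum-multiplicity-const M (proj₁ ∘ proj₂ ∘ xs∈)) (sym h≡mr) ,
    (begin
      x                                          ≈⟨ x≈ ⟩
      ∑ G r xs                                   ≡⟨ ∑≡sum r xs ⟩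
      sum xs                                     ≈⟨ sum-cong-≋ (λ j → proj₂ (proj₂ (xs∈ j))) ⟩
      sum (λ j → subsetSum G a (M j))            ≈⟨ sum-subsetSum a M ⟩
      sum (λ i → multiplicity M i ×ᴳ a i)        ≈⟨ ∑·≈sum× (multiplicity M) a ⟨
      ∑ G k (λ i → _·_ G (multiplicity M i) (a i)) ∎)
    where
      M : Fin r → Subset k
      M j = proj₁ (xs∈ j)

lemma1 : {c ℓ : Level} (G : AbelianGroup c ℓ) (r m h k : ℕ) (a : Fin k → AbelianGroup.Carrier G) →
    Distinct G a → 1 ≤ r → 1 ≤ m → h ≡ m * r → h ≤ r * k → 1 ≤ h →
    (x : AbelianGroup.Carrier G) →
      (genSumset G a h r x → foldSumset G r (restrSumset G a m) x)
      × (foldSumset G r (restrSumset G a m) x → genSumset G a h r x)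
lemma1 G r m h k a _ 1≤r _ h≡mr _ _ x =
  genSumset⇒foldSumset G a 1≤r h≡mr , foldSumset⇒genSumset G a h≡mr
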